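{- For every $g\ge 3$, $\gamma_g^1\ge \gamma_g^2$.
   Context: Pseudofractal scale-free web: $\mathcal{G}_1$ is a triangle; $\mathcal{G}_{g+1}$ is obtained from $\mathcal{G}_g$ by adding, for every edge $uv$ of $\mathcal{G}_g$, a new vertex adjacent to exactly $u$ and $v$. The three vertices of $\mathcal{G}_1$ are the hub vertices. For $g\ge 2$, $I_g=\mathcal{G}_{g-1}$, with hub vertices those of $\mathcal{G}_{g-1}$. $\gamma_g^1$ (resp. $\gamma_g^2$) denotes the minimum cardinality of a vertex cover of $I_g$ containing exactly two (resp. exactly three) hub vertices. -}

module Defs where

open import Data.Nat using (ℕ; zero; suc; _+_; _∸_; _≤_; _<_; _<?_)
open import Data.Product using (_×_; _,_; proj₁; proj₂; Σ; ∃)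
open import Data.Sum using (_⊎_)
open import Relation.Binary.PropositionalEquality using (_≡_)
open import Data.List using (List; []; _∷_; _++_; length; filter)
open import Data.List.Relation.Unary.All using (All)
open import Data.List.Membership.Propositional using (_∈_)
open import Data.List.Relation.Unary.Unique.Propositional using (Unique)

-- A finite simple graph on vertex set {0, …, nV - 1}, given by its edge list.
record Graph : Set where
  constructor mkGraph
  field
    nV    : ℕ
    edges : List (ℕ × ℕ)
open Graph public

newEdges : ℕ → List (ℕ × ℕ) → List (ℕ × ℕ)
newEdges k []             = []
newEdges k ((u , v) ∷ es) = (k , u) ∷ (k , v) ∷ newEdges (suc k) es

step : Graph → Graph
step (mkGraph n es) = mkGraph (n + length es) (es ++ newEdges n es)

-- The triangle G_1 on hub vertices 0, 1, 2.
triangle : Graph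
triangle = mkGraph 3 ((0 , 1) ∷ (1 , 2) ∷ (0 , 2) ∷ [])

-- Gsuc n = G_{n+1}
Gsuc : ℕ → Graph
Gsuc zero    = triangle
Gsuc (suc n) = step (Gsuc n)

-- G g = 𝒢_g  (meaningful for g ≥ 1)
G : ℕ → Graph
G g = Gsuc (g ∸ 1)

-- I g = 𝒢_{g-1}  (meaningful for g ≥ 2); hub vertices are 0, 1, 2.
I : ℕ → Graph
I g = G (g ∸ 1)

IsVertexCover : Graph → List ℕ → Set
IsVertexCover Γ C =
  Unique C × All (λ x → x < nV Γ) C
  × All (λ e → proj₁ e ∈ C ⊎ proj₂ e ∈ C) (edges Γ)

hubCount : List ℕ → ℕ
hubCount C = length (filter (λ x → x <? 3) C)

IsMinCoverWithHubs : ℕ → Graph → ℕ → Set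
IsMinCoverWithHubs k Γ m =
  Σ (List ℕ) (λ C → IsVertexCover Γ C × hubCount C ≡ k × length C ≡ m)
  × (∀ C → IsVertexCover Γ C → hubCount C ≡ k → m ≤ length C)

IsGamma1 : ℕ → ℕ → Set
IsGamma1 g m = IsMinCoverWithHubs 2 (I g) m

IsGamma2 : ℕ → ℕ → Set
IsGamma2 g m = IsMinCoverWithHubs 3 (I g) m

-- Let C be a vertex cover of 𝒢_{g-1} containing exactly two hubs, say h ∉ C, and let x be a
-- hub joined to h by a triangle edge, so x ∈ C. The vertex v that 𝒢_{g-1} = step 𝒢_{g-2} adds
-- for the edge hx has neighbours h and x only; since hv must be covered, v ∈ C. Trading v for
-- h gives a cover of the same size in which every edge at v is still covered (by h or by x),
-- now containing all three hubs.
module Submission where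

open import Defs
open import Data.Nat using (ℕ; _≤_; suc; _+_; _<_; _<?_; _≟_; s≤s; z<s; s<s)
open import Data.Nat.Properties
open import Data.Product using (_×_; _,_; proj₁; proj₂; ∃)
open import Data.Sum as Sum using (_⊎_; inj₁; inj₂; fromInj₁; fromInj₂; [_,_]′)
open import Data.Empty using (⊥-elim)
open import Function using (_∘_; case_of_)
open import Level using (Level)
open import Relation.Nullary using (¬_; yes; no)
open import Relation.Unary using (Pred; Decidable)
open import Relation.Binary.PropositionalEquality using (_≡_; refl; sym; trans; cong; subst; _≢_; ≢-sym)
open import Data.List using (List; []; _∷_; _++_; length; filter; map)
open import Data.List.Properties using (length-map; filter-accept; filter-reject; map-id-local)
open import Data.List.Relation.Unary.All as All using (All; []; _∷_)
open import Data.List.Relation.Unary.All.Properties using (++⁺; ++⁻ˡ; ++⁻ʳ; All¬⇒¬Any; map⁺)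
open import Data.List.Relation.Unary.Any using (here; there)
open import Data.List.Membership.Propositional using (_∈_; _∉_)
open import Data.List.Membership.Propositional.Properties
  using (∈-map⁺; ∈-filter⁺; ∈-++⁺ˡ; ∈-++⁺ʳ; ∈-∃++; ∈-length)
open import Data.List.Membership.DecPropositional _≟_ using (_∈?_)
open import Data.List.Relation.Unary.Unique.Propositional using (Unique)
open import Data.List.Relation.Unary.AllPairs using ([]; _∷_)

private
  variable
    p : Level
    A : Set
    a b c : A
    as : List A
    x y z v h : ℕ
    L : List ℕ

∉⇒≢ : a ∈ as → b ∉ as → a ≢ b
∉⇒≢ a∈ b∉ refl = b∉ a∈

2≤length : a ≢ b → a ∈ as → b ∈ as → 2 ≤ length as
2≤length x≢y (here refl) (here refl) = ⊥-elim (x≢y refl)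
2≤length _   (here _)    (there y∈)  = s≤s (∈-length y∈)
2≤length _   (there x∈)  (here _)    = s≤s (∈-length x∈)
2≤length x≢y (there x∈)  (there y∈)  = m≤n⇒m≤1+n (2≤length x≢y x∈ y∈)

3≤length : a ≢ b → a ≢ c → b ≢ c → a ∈ as → b ∈ as → c ∈ as → 3 ≤ length as
3≤length x≢y _   _   (here refl) (here refl) _           = ⊥-elim (x≢y refl)
3≤length _   x≢z _   (here refl) _           (here refl) = ⊥-elim (x≢z refl)
3≤length _   _   y≢z _           (here refl) (here refl) = ⊥-elim (y≢z refl)
3≤length _   _   y≢z (here _)    (there y∈)  (there z∈)  = s≤s (2≤length y≢z y∈ z∈)
3≤length _   x≢z _   (there x∈)  (here _)    (there z∈)  = s≤s (2≤length x≢z x∈ z∈)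
3≤length x≢y _   _   (there x∈)  (there y∈)  (here _)    = s≤s (2≤length x≢y x∈ y∈)
3≤length x≢y x≢z y≢z (there x∈)  (there y∈)  (there z∈)  =
  m≤n⇒m≤1+n (3≤length x≢y x≢z y≢z x∈ y∈ z∈)

replace : ℕ → ℕ → ℕ → ℕ
replace v h y with y ≟ v
... | yes _ = h
... | no  _ = y

replace-≡ : ∀ v h → replace v h v ≡ h
replace-≡ v h with v ≟ v
... | yes _   = refl
... | no  v≢v = ⊥-elim (v≢v refl)

replace-≢ : y ≢ v → replace v h y ≡ y
replace-≢ {y} {v} y≢v with y ≟ v
... | yes y≡v = ⊥-elim (y≢v y≡v)
... | no  _   = refl

replace-preserves : ∀ {P : Pred ℕ p} → P h → P y → P (replace v h y)
replace-preserves {y = y} {v} Ph Py with y ≟ v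
... | yes _ = Ph
... | no  _ = Py

replace-injective : y ≢ h → z ≢ h → replace v h y ≡ replace v h z → y ≡ z
replace-injective {y} {h} {z} {v} y≢h z≢h eq with y ≟ v | z ≟ v
... | yes refl | yes refl = refl
... | yes _    | no  _    = ⊥-elim (z≢h (sym eq))
... | no  _    | yes _    = ⊥-elim (y≢h eq)
... | no  _    | no  _    = eq

map-replace-∉ : v ∉ L → map (replace v h) L ≡ L
map-replace-∉ v∉ = map-id-local (All.tabulate λ y∈ → replace-≢ (∉⇒≢ y∈ v∉))

∈-map-replace : y ∈ L → y ≢ v → y ∈ map (replace v h) L
∈-map-replace {y} {L} {v} {h} y∈ y≢v =
  subst (_∈ map (replace v h) L) (replace-≢ y≢v) (∈-map⁺ (replace v h) y∈)

∈-map-replace-≡ : v ∈ L → h ∈ map (replace v h) L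
∈-map-replace-≡ {v} {L} {h} v∈ =
  subst (_∈ map (replace v h) L) (replace-≡ v h) (∈-map⁺ (replace v h) v∈)

unique-map-replace : h ∉ L → Unique L → Unique (map (replace v h) L)
unique-map-replace h∉ [] = []
unique-map-replace {h} {y ∷ L} h∉ (y≢ ∷ unique) =
  map⁺ (All.tabulate λ z∈ → All.lookup y≢ z∈ ∘
    replace-injective (∉⇒≢ (here refl) h∉) (∉⇒≢ (there z∈) h∉))
  ∷ unique-map-replace (h∉ ∘ there) unique

length-filter-map-replace : ∀ {P : Pred ℕ p} (P? : Decidable P) → P h → ¬ P v → v ∈ L → Unique L →
                            length (filter P? (map (replace v h) L)) ≡ suc (length (filter P? L))
length-filter-map-replace {h = h} {v} {v ∷ L} P? Ph ¬Pv (here refl) (v≢ ∷ _)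
  rewrite replace-≡ v h | map-replace-∉ {h = h} (All¬⇒¬Any v≢)
        | filter-accept P? {h} {L} Ph | filter-reject P? {v} {L} ¬Pv = refl
length-filter-map-replace {h = h} {v} {y ∷ L} P? Ph ¬Pv (there v∈) (y≢ ∷ unique) =
  trans (cong (λ z → length (filter P? (z ∷ map (replace v h) L))) (replace-≢ (All.lookup y≢ v∈)))
        (length-filter-∷ (length-filter-map-replace P? Ph ¬Pv v∈ unique))
  where
  length-filter-∷ : ∀ {L₁ L₂} → length (filter P? L₁) ≡ suc (length (filter P? L₂)) →
                    length (filter P? (y ∷ L₁)) ≡ suc (length (filter P? (y ∷ L₂)))
  length-filter-∷ eq with P? y
  ... | yes _ = cong suc eq
  ... | no  _ = eq

Incident : ℕ → ℕ × ℕ → Set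
Incident a e = proj₁ e ≡ a ⊎ proj₂ e ≡ a

NeighboursAmong : Graph → ℕ → ℕ → ℕ → Set
NeighboursAmong Γ v a b = All (λ e → Incident v e → Incident a e ⊎ Incident b e) (edges Γ)

NeighboursAmong-swap : ∀ {Γ a b} → NeighboursAmong Γ v a b → NeighboursAmong Γ v b a
NeighboursAmong-swap = All.map (Sum.swap ∘_)

replace-cover : ∀ {Γ C} → IsVertexCover Γ C → v ∈ C → x ∈ C → x ≢ v → h ∉ C → h < nV Γ →
                NeighboursAmong Γ v h x → IsVertexCover Γ (map (replace v h) C)
replace-cover {v} {x} {h} {Γ} {C} (unique , below , covers) v∈ x∈ x≢v h∉ h<n nbrs =
  unique-map-replace h∉ unique ,
  map⁺ (All.map (replace-preserves {P = _< nV Γ} h<n) below) ,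
  All.zipWith (λ (at-v , covered) → cover-edge at-v covered) (nbrs , covers)
  where
  C′ : List ℕ
  C′ = map (replace v h) C

  endpoint : ∀ {a b} → Incident h (a , b) ⊎ Incident x (a , b) → a ∈ C′ ⊎ b ∈ C′
  endpoint (inj₁ (inj₁ refl)) = inj₁ (∈-map-replace-≡ v∈)
  endpoint (inj₁ (inj₂ refl)) = inj₂ (∈-map-replace-≡ v∈)
  endpoint (inj₂ (inj₁ refl)) = inj₁ (∈-map-replace x∈ x≢v)
  endpoint (inj₂ (inj₂ refl)) = inj₂ (∈-map-replace x∈ x≢v)

  cover-edge : ∀ {e} → (Incident v e → Incident h e ⊎ Incident x e) →
               proj₁ e ∈ C ⊎ proj₂ e ∈ C → proj₁ e ∈ C′ ⊎ proj₂ e ∈ C′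
  cover-edge {a , b} at-v covered with a ≟ v | b ≟ v
  ... | yes a≡v | _       = endpoint (at-v (inj₁ a≡v))
  ... | no  _   | yes b≡v = endpoint (at-v (inj₂ b≡v))
  ... | no  a≢v | no  b≢v =
    Sum.map (λ a∈ → ∈-map-replace a∈ a≢v) (λ b∈ → ∈-map-replace b∈ b≢v) covered

exchange : ∀ {Γ C} → IsVertexCover Γ C → h ∉ C → x ∈ C → (v , h) ∈ edges Γ →
           NeighboursAmong Γ v h x → h < 3 → x < 3 → 3 ≤ v → h < nV Γ →
           ∃ λ C′ → IsVertexCover Γ C′ × hubCount C′ ≡ suc (hubCount C) × length C′ ≡ length C
exchange {h} {x} {v} {Γ} {C} cover@(unique , _ , covers) h∉ x∈ vh∈ nbrs h<3 x<3 3≤v h<n =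
  map (replace v h) C ,
  replace-cover cover v∈ x∈ x≢v h∉ h<n nbrs ,
  length-filter-map-replace (_<? 3) h<3 (≤⇒≯ 3≤v) v∈ unique ,
  length-map (replace v h) C
  where
  v∈ : v ∈ C
  v∈ = fromInj₁ (⊥-elim ∘ h∉) (All.lookup covers vh∈)

  x≢v : x ≢ v
  x≢v refl = <⇒≱ x<3 3≤v

EdgesBelow : ℕ → List (ℕ × ℕ) → Set
EdgesBelow n = All (λ e → proj₁ e < n × proj₂ e < n)

EdgesBelow-mono : ∀ {m n es} → m ≤ n → EdgesBelow m es → EdgesBelow n es
EdgesBelow-mono m≤n = All.map λ (a<m , b<m) → <-≤-trans a<m m≤n , <-≤-trans b<m m≤n

newEdges-bounds : ∀ {n} k es → EdgesBelow n es →
                  All (λ e → k ≤ proj₁ e × proj₁ e < k + length es × proj₂ e < n) (newEdges k es)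
newEdges-bounds k [] [] = []
newEdges-bounds k ((a , b) ∷ es) ((a<n , b<n) ∷ below) =
  (≤-refl , k<k+1+l , a<n) ∷ (≤-refl , k<k+1+l , b<n) ∷
  All.map (λ (k<e , e<k+l , e′<n) → <⇒≤ k<e , <-≤-trans e<k+l (≤-reflexive (sym (+-suc k _))) , e′<n)
          (newEdges-bounds (suc k) es below)
  where
  k<k+1+l : k < k + suc (length es)
  k<k+1+l = ≤-trans (s≤s (m≤m+n k (length es))) (≤-reflexive (sym (+-suc k _)))

newEdges-++ : ∀ k (xs ys : List (ℕ × ℕ)) →
              newEdges k (xs ++ ys) ≡ newEdges k xs ++ newEdges (k + length xs) ys
newEdges-++ k [] ys rewrite +-identityʳ k = refl
newEdges-++ k ((a , b) ∷ xs) ys rewrite newEdges-++ (suc k) xs ys | +-suc k (length xs) = refl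

step-EdgesBelow : ∀ {Γ} → EdgesBelow (nV Γ) (edges Γ) → EdgesBelow (nV (step Γ)) (edges (step Γ))
step-EdgesBelow {Γ} below =
  ++⁺ (EdgesBelow-mono n≤n+l below)
      (All.map (λ (_ , a<n+l , b<n) → a<n+l , <-≤-trans b<n n≤n+l) (newEdges-bounds (nV Γ) (edges Γ) below))
  where
  n≤n+l : nV Γ ≤ nV (step Γ)
  n≤n+l = m≤m+n (nV Γ) (length (edges Γ))

-- newEdges numbers the new vertices by edge position: for edges Γ = pre ++ (u , w) ∷ post the
-- witness is nV Γ + length pre.
step-new-vertex : ∀ {Γ u w} → EdgesBelow (nV Γ) (edges Γ) → (u , w) ∈ edges Γ →
                  ∃ λ v → nV Γ ≤ v × (v , u) ∈ edges (step Γ) × (v , w) ∈ edges (step Γ)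
                        × NeighboursAmong (step Γ) v u w
step-new-vertex {mkGraph n es} {u} {w} below uw∈ with ∈-∃++ uw∈
... | pre , post , refl rewrite newEdges-++ n pre ((u , w) ∷ post) =
  new , m≤m+n n (length pre) ,
  ∈-++⁺ʳ es (∈-++⁺ʳ (newEdges n pre) (here refl)) ,
  ∈-++⁺ʳ es (∈-++⁺ʳ (newEdges n pre) (there (here refl))) ,
  ++⁺ (All.map (λ (a<n , b<n) → vacuous (below-v a<n) (below-v b<n)) below)
      (++⁺ (All.map (λ (_ , a<new , b<n) → vacuous (<⇒≢ a<new) (below-v b<n))
                    (newEdges-bounds n pre (++⁻ˡ pre below)))
           ((λ _ → inj₁ (inj₂ refl)) ∷ (λ _ → inj₂ (inj₂ refl)) ∷
            All.map (λ (new<a , _ , b<n) → vacuous (≢-sym (<⇒≢ new<a)) (below-v b<n))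
                    (newEdges-bounds (suc new) post (All.tail (++⁻ʳ pre below)))))
  where
  new : ℕ
  new = n + length pre

  below-v : ∀ {a} → a < n → a ≢ new
  below-v a<n = <⇒≢ (<-≤-trans a<n (m≤m+n n (length pre)))

  vacuous : ∀ {a b} {Q : Set} → a ≢ new → b ≢ new → Incident new (a , b) → Q
  vacuous a≢new b≢new = ⊥-elim ∘ [ a≢new , b≢new ]′

triangle-EdgesBelow : EdgesBelow 3 (edges triangle)
triangle-EdgesBelow = (z<s , s<s z<s) ∷ (s<s z<s , s<s (s<s z<s)) ∷ (z<s , s<s (s<s z<s)) ∷ []

Gsuc-EdgesBelow : ∀ k → EdgesBelow (nV (Gsuc k)) (edges (Gsuc k))
Gsuc-EdgesBelow 0       = triangle-EdgesBelow
Gsuc-EdgesBelow (suc k) = step-EdgesBelow (Gsuc-EdgesBelow k)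

3≤nV-Gsuc : ∀ k → 3 ≤ nV (Gsuc k)
3≤nV-Gsuc 0       = ≤-refl
3≤nV-Gsuc (suc k) = ≤-trans (3≤nV-Gsuc k) (m≤m+n _ _)

triangle-⊆-Gsuc : ∀ k {e} → e ∈ edges triangle → e ∈ edges (Gsuc k)
triangle-⊆-Gsuc 0       e∈ = e∈
triangle-⊆-Gsuc (suc k) e∈ = ∈-++⁺ˡ (triangle-⊆-Gsuc k e∈)

triangle-edge-leaving : ∀ C → hubCount C ≡ 2 →
                        ∃ λ e → e ∈ edges triangle × (proj₁ e ∉ C ⊎ proj₂ e ∉ C)
triangle-edge-leaving C two with 0 ∈? C | 1 ∈? C | 2 ∈? C
... | no 0∉ | _     | _     = (0 , 1) , here refl , inj₁ 0∉
... | yes _ | no 1∉ | _     = (0 , 1) , here refl , inj₂ 1∉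
... | yes _ | yes _ | no 2∉ = (1 , 2) , there (here refl) , inj₂ 2∉
... | yes 0∈ | yes 1∈ | yes 2∈ =
  ⊥-elim (<⇒≱ (s<s (s<s z<s)) (subst (3 ≤_) two
    (3≤length (λ ()) (λ ()) (λ ()) (hub 0∈ z<s) (hub 1∈ (s<s z<s)) (hub 2∈ (s<s (s<s z<s))))))
  where
  hub : x ∈ C → x < 3 → x ∈ filter (_<? 3) C
  hub = ∈-filter⁺ (_<? 3)

add-hub-to-cover : ∀ k {C} → IsVertexCover (Gsuc (suc k)) C → hubCount C ≡ 2 →
                   ∃ λ C′ → IsVertexCover (Gsuc (suc k)) C′
                          × hubCount C′ ≡ suc (hubCount C) × length C′ ≡ length C
add-hub-to-cover k {C} cover@(_ , _ , covers) two =
  let (u , w) , uw∈ , leaving = triangle-edge-leaving C two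
      u<3 , w<3 = All.lookup triangle-EdgesBelow uw∈
      v , n≤v , vu∈ , vw∈ , nbrs = step-new-vertex (Gsuc-EdgesBelow k) (triangle-⊆-Gsuc k uw∈)
      3≤v = ≤-trans (3≤nV-Gsuc k) n≤v
      uw-covered = All.lookup covers (triangle-⊆-Gsuc (suc k) uw∈)
  in case leaving of λ where
       (inj₁ u∉) → exchange cover u∉ (fromInj₂ (⊥-elim ∘ u∉) uw-covered) vu∈ nbrs
                            u<3 w<3 3≤v (hub<nV u<3)
       (inj₂ w∉) → exchange cover w∉ (fromInj₁ (⊥-elim ∘ w∉) uw-covered) vw∈
                            (NeighboursAmong-swap {Γ = Gsuc (suc k)} nbrs)
                            w<3 u<3 3≤v (hub<nV w<3)
  where
  hub<nV : x < 3 → x < nV (Gsuc (suc k))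
  hub<nV x<3 = <-≤-trans x<3 (3≤nV-Gsuc (suc k))

lemma5 : ∀ (g : ℕ) → 3 ≤ g → ∀ (m₁ m₂ : ℕ) → IsGamma1 g m₁ → IsGamma2 g m₂ → m₂ ≤ m₁
lemma5 (suc (suc (suc k))) _ _ m₂ ((C , cover , two , refl) , _) (_ , minimal) =
  let C′ , cover′ , more , same = add-hub-to-cover k cover two
  in subst (m₂ ≤_) same (minimal C′ cover′ (trans more (cong suc two)))
lemma5 0 ()
lemma5 1 (s≤s ())
lemma5 2 (s≤s (s≤s ()))
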